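{- Let $\mathcal A\colon l+m\to l+n$ be a rightward open MDP, $i\in[l]$, and $s,s'\in[l+1,l+n]+Q^{\mathcal A}$. If $i\in\mathrm{prec}(s)$ and $i\in\mathrm{prec}(s')$, then $s=s'$.
   Context: Notation: $[k]=\{1,\dots,k\}$, $[a,b]=\{a,\dots,b\}$, $+$ disjoint union. A rightward open MDP $\mathcal A\colon p\to q$ over a finite nonempty action set $A$ is $(p,q,Q,A,E,P,R)$ with $Q$ a finite set of positions, entry function $E\colon[p]\to Q+[q]$ (entrances $[p]$, exits $[q]$), transition probabilities $P\colon Q\times A\times(Q+[q])\to\mathbb R_{\ge0}$ summing to $0$ or $1$ for each $(s,a)$, and rewards $R\colon Q\to\mathbb R_{\ge0}$, satisfying unique access to exits (distinct elements of $[p]+Q$ reach disjoint sets of exits in one step; each exit is reached from a given position by at most one action). For $\mathcal A\colon l+m\to l+n$, elements of $[l]$ are regarded both as exits and (via the loop of the trace) as entrances, and for $t\in[l+1,l+n]+Q^{\mathcal A}$, $\mathrm{prec}(t)$ is the set of $i\in[l]$ for which there exist $i_0,\dots,i_k$ with $i_0=i$, $i_{j+1}=E^{\mathcal A}(i_j)$ for each $j<k$, $i_0,\dots,i_{k-1}\in[l]$ and $i_k=t$.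
   Formalization: The transition probabilities P and the rewards R take values in the nonnegative rationals instead of the nonnegative reals. -}

module Defs where

open import Data.Nat using (ℕ; zero; suc; _+_; _≤_)
open import Data.Fin using (Fin; zero; suc; _↑ˡ_; _↑ʳ_)
open import Data.Sum using (_⊎_; inj₁; inj₂)
open import Data.Product using (∃)
open import Relation.Binary.PropositionalEquality using (_≡_)
import Data.Rational as ℚ
open ℚ using (ℚ; 0ℚ; 1ℚ)

sumFin : (k : ℕ) → (Fin k → ℚ) → ℚ
sumFin zero    f = 0ℚ
sumFin (suc k) f = f zero ℚ.+ sumFin k (λ j → f (suc j))

ReachesExit : ∀ {nA p q nQ} → (Fin p → Fin nQ ⊎ Fin q) →
              (Fin nQ → Fin nA → Fin nQ ⊎ Fin q → ℚ) →
              Fin p ⊎ Fin nQ → Fin q → Set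
ReachesExit E P (inj₁ e) j = E e ≡ inj₂ j
ReachesExit E P (inj₂ s) j = ∃ λ a → 0ℚ ℚ.< P s a (inj₂ j)

-- Real numbers are rendered by rationals.
record OpenMDP (nA p q : ℕ) : Set where
  field
    nQ        : ℕ
    A-nonempty : 1 ≤ nA
    E         : Fin p → Fin nQ ⊎ Fin q
    P         : Fin nQ → Fin nA → Fin nQ ⊎ Fin q → ℚ
    R         : Fin nQ → ℚ
    P-nonneg  : ∀ s a t → 0ℚ ℚ.≤ P s a t
    P-sum     : ∀ s a →
                let total = sumFin nQ (λ t → P s a (inj₁ t)) ℚ.+ sumFin q (λ j → P s a (inj₂ j))
                in (total ≡ 0ℚ) ⊎ (total ≡ 1ℚ)
    R-nonneg  : ∀ s → 0ℚ ℚ.≤ R s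
    unique-source : ∀ x y j → ReachesExit E P x j → ReachesExit E P y j → x ≡ y
    unique-action : ∀ s a a' j → 0ℚ ℚ.< P s a (inj₂ j) → 0ℚ ℚ.< P s a' (inj₂ j) → a ≡ a'

open OpenMDP public

-- For 𝒜 : l+m → l+n, the elements of [l+1,l+n] + Q^𝒜, embedded into Q + [l+n].
embedTarget : ∀ {nA} l m n (𝒜 : OpenMDP nA (l + m) (l + n)) →
              Fin n ⊎ Fin (nQ 𝒜) → Fin (nQ 𝒜) ⊎ Fin (l + n)
embedTarget l m n 𝒜 (inj₁ j) = inj₂ (l ↑ʳ j)
embedTarget l m n 𝒜 (inj₂ s) = inj₁ s

-- i ∈ prec(t): a chain i = i₀, i₁ = E(i₀), …, i_k = t with i₀,…,i_{k-1} ∈ [l]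
-- (entrance i ∈ [l] is i ↑ˡ m ∈ [l+m]; exit i ∈ [l] is i ↑ˡ n ∈ [l+n]).
data Prec {nA} (l m n : ℕ) (𝒜 : OpenMDP nA (l + m) (l + n)) :
          Fin l → Fin n ⊎ Fin (nQ 𝒜) → Set where
  last : ∀ {i t} → E 𝒜 (i ↑ˡ m) ≡ embedTarget l m n 𝒜 t → Prec l m n 𝒜 i t
  step : ∀ {i i' t} → E 𝒜 (i ↑ˡ m) ≡ inj₂ (i' ↑ˡ n) →
         Prec l m n 𝒜 i' t → Prec l m n 𝒜 i t

-- The chain witnessing i ∈ prec(t) is forced: each step applies the function E to the
-- current element, and whether the chain stops or continues is read off from whether
-- the value lies among the loop exits [l] or among the targets [l+1,l+n] + Q, two
-- disjoint sets on which the embedding of targets is injective.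
module Submission where

open import Defs
open import Data.Nat using (ℕ; _+_)
open import Data.Fin using (Fin; _↑ˡ_; _↑ʳ_; splitAt)
open import Data.Fin.Properties using (↑ˡ-injective; ↑ʳ-injective; splitAt-↑ˡ; splitAt-↑ʳ)
open import Data.Sum using (_⊎_; inj₁; inj₂)
open import Data.Sum.Properties using (inj₁-injective; inj₂-injective)
open import Data.Empty using (⊥-elim)
open import Relation.Binary.PropositionalEquality using (_≡_; _≢_; refl; sym; trans; cong)

-- splitAt l sends the left side to inj₁ and the right side to inj₂.
↑ʳ≢↑ˡ : ∀ l n (j : Fin n) (i : Fin l) → l ↑ʳ j ≢ i ↑ˡ n
↑ʳ≢↑ˡ l n j i eq with trans (sym (splitAt-↑ʳ l n j)) (trans (cong (splitAt l) eq) (splitAt-↑ˡ l i n))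
... | ()

module _ {nA} (l m n : ℕ) (𝒜 : OpenMDP nA (l + m) (l + n)) where

  embedTarget-injective : ∀ t t' → embedTarget l m n 𝒜 t ≡ embedTarget l m n 𝒜 t' → t ≡ t'
  embedTarget-injective (inj₁ j) (inj₁ j') eq = cong inj₁ (↑ʳ-injective l j j' (inj₂-injective eq))
  embedTarget-injective (inj₂ s) (inj₂ s') eq = cong inj₂ (inj₁-injective eq)

  embedTarget≢loopExit : ∀ t (i : Fin l) → embedTarget l m n 𝒜 t ≢ inj₂ (i ↑ˡ n)
  embedTarget≢loopExit (inj₁ j) i eq = ↑ʳ≢↑ˡ l n j i (inj₂-injective eq)

  Prec-functional : ∀ {i s s'} → Prec l m n 𝒜 i s → Prec l m n 𝒜 i s' → s ≡ s'
  Prec-functional {s = s} {s'} (last p) (last q) = embedTarget-injective s s' (trans (sym p) q)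
  Prec-functional {s = s} (last p) (step {i' = i'} q _) = ⊥-elim (embedTarget≢loopExit s i' (trans (sym p) q))
  Prec-functional {s' = s'} (step {i' = i'} p _) (last q) = ⊥-elim (embedTarget≢loopExit s' i' (trans (sym q) p))
  Prec-functional (step {i' = i'} p r) (step {i' = i''} q r')
    with ↑ˡ-injective n i' i'' (inj₂-injective (trans (sym p) q))
  ... | refl = Prec-functional r r'

lemma1 : (nA l m n : ℕ) (𝒜 : OpenMDP nA (l + m) (l + n)) (i : Fin l)
         (s s' : Fin n ⊎ Fin (nQ 𝒜)) →
         Prec l m n 𝒜 i s → Prec l m n 𝒜 i s' → s ≡ s'
lemma1 nA l m n 𝒜 i s s' = Prec-functional l m n 𝒜
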